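{- Let $\mathbf 2$ be the structure with universe $\{0,1\}$ in which both elements are named by constant symbols. Then $\mathrm{Cs}_{\mathrm{IFG}_1}(\mathbf 2)$ is hereditarily simple, i.e., every subalgebra of $\mathrm{Cs}_{\mathrm{IFG}_1}(\mathbf 2)$ (including itself) has only the identity relation and the total relation as congruences.
   Context: Teams and operations. For a set $A$ and $N\in\mathbb N$ (identify $N$ with $\{0,\dots,N-1\}$), ${}^NA$ is the set of valuations $\vec a=(a_0,\dots,a_{N-1})$; a team is a subset of ${}^NA$ (for $N=1$ identify ${}^1A$ with $A$). For $J\subseteq N$, $\vec a\approx_J\vec b$ means they agree on $N\setminus J$. $V=V_1\cup_J V_2$ means $V_1\cup V_2=V$, $V_1\cap V_2=\emptyset$, and each $V_i$ is closed under $\approx_J$ within $V$. $f:V\to A$ is independent of $J$ if $f(\vec a)=f(\vec b)$ whenever $\vec a\approx_J\vec b$. $\vec a(n:b)$ is $\vec a$ with $n$th coordinate replaced by $b$; $V(n:f)=\{\vec a(n:f(\vec a)):\vec a\in V\}$; $W(n:A)=\{\vec a(n:b):\vec a\in W,b\in A\}$. The IFG-cylindric power set algebra with base set $A$ and dimension $N$ has universe $\mathcal P(\mathcal P({}^NA))\times\mathcal P(\mathcal P({}^NA))$, elements written $X=\langle X^+,X^-\rangle$, and operations: $0=\langle\{\emptyset\},\mathcal P({}^NA)\rangle$, $1=\langle\mathcal P({}^NA),\{\emptyset\}\rangle$, $D_{ij}=\langle\mathcal P(\{\vec a:a_i=a_j\}),\mathcal P(\{\vec a:a_i\neq a_j\})\rangle$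 ($i,j<N$); $\neg X=\langle X^-,X^+\rangle$; for $J\subseteq N$: $(X+_JY)^+=\{V:V=V_1\cup_JV_2,\ V_1\in X^+,V_2\in Y^+\}$, $(X+_JY)^-=X^-\cap Y^-$; $(X\cdot_JY)^+=X^+\cap Y^+$, $(X\cdot_JY)^-=\{W:W=W_1\cup_JW_2,\ W_1\in X^-,W_2\in Y^-\}$; for $n<N$, $J\subseteq N$: $C_{n,J}(X)^+=\{V:V(n:f)\in X^+$ for some $f:V\to A$ independent of $J\}$, $C_{n,J}(X)^-=\{W:W(n:A)\in X^-\}$. IFG$_N$-formulas in variables $v_0,\dots,v_{N-1}$ are built from atomic first-order formulas by $\sim\phi$, $\phi\vee_{/J}\psi$ and $(\exists v_n/J)\phi$ ($J\subseteq N$, $n<N$). For a structure $\mathfrak A$ with universe $A$, $\mathfrak A\models^+\phi[V]$ and $\mathfrak A\models^-\phi[W]$ are defined recursively: atomic: every $\vec a\in V$ satisfies $\phi$ / no $\vec b\in W$ satisfies $\phi$; $\sim$ swaps $+$ and $-$; $\psi_1\vee_{/J}\psi_2$: $+$ on $V$ iff $+$ for $\psi_1$ on $V_1$ and for $\psi_2$ on $V_2$ for some $V=V_1\cup_JV_2$, $-$ on $W$ iff both $\psi_i$ are $-$ on $W$; $(\exists v_n/J)\psi$: $+$ on $V$ iff $\psi$ is $+$ on $V(n:f)$ for some $f:V\to A$ independent of $J$, $-$ on $W$ iff $\psi$ is $-$ on $W(n:A)$. The meaning is $\|\phi\|_{\mathfrak A}=\langle\{V:\mathfrak A\models^+\phi[V]\},\{W:\mathfrak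 A\models^-\phi[W]\}\rangle$. $\mathrm{Cs}_{\mathrm{IFG}_N}(\mathfrak A)$ is the set of meanings of all IFG$_N$-formulas in the signature of $\mathfrak A$, as a subalgebra of the IFG-cylindric power set algebra with base set $A$ and dimension $N$. A congruence is an equivalence relation preserved by all operations. An algebra is simple if its only congruences are the identity relation and the total relation, and hereditarily simple if all of its subalgebras are simple. -}

module Defs where

open import Data.Bool using (Bool; true; false; _∧_; _∨_; not; if_then_else_)
open import Data.Product using (Σ; _×_; _,_)
open import Data.Sum using (_⊎_)
open import Relation.Binary.PropositionalEquality using (_≡_)

-- Conventions (dimension N = 1, base set A = {0,1}).
--  * A = Bool, with false = 0 and true = 1.
--  * N = 1 = {0}; a valuation in ^1A is identified with an element of A.
--  * A subset J ⊆ N = {0} is a Bool: true iff 0 ∈ J.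
--  * Since everything is finite, all subsets are represented by their
--    (Bool-valued) characteristic functions, and all quantifiers over
--    finite sets are computed by exhaustive enumeration.

A : Set
A = Bool

Idx : Set
Idx = Bool

_⇒ᵇ_ : Bool → Bool → Bool
a ⇒ᵇ b = not a ∨ b

eqA : A → A → Bool
eqA false false = true
eqA true  true  = true
eqA _     _     = false

allA : (A → Bool) → Bool
allA p = p false ∧ p true

anyA : (A → Bool) → Bool
anyA p = p false ∨ p true

-- Teams: subsets of ^1A = A, given by membership bits.
record Team : Set where
  constructor team
  field
    has0 : Bool
    has1 : Bool

mem : A → Team → Bool
mem false V = Team.has0 V
mem true  V = Team.has1 V

mkTeam : (A → Bool) → Team
mkTeam p = team (p false) (p true)

allTeam : (Team → Bool) → Bool
allTeam p = p (team false false) ∧ p (team true false) ∧ p (team false true) ∧ p (team true true)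

anyTeam : (Team → Bool) → Bool
anyTeam p = p (team false false) ∨ p (team true false) ∨ p (team false true) ∨ p (team true true)

-- Sets of teams (elements of P(P(^1A))), one bit per team.
record TeamSet : Set where
  constructor teamSet
  field
    atEmpty : Bool
    at0     : Bool
    at1     : Bool
    at01    : Bool

_∋_ : TeamSet → Team → Bool
T ∋ team false false = TeamSet.atEmpty T
T ∋ team true  false = TeamSet.at0 T
T ∋ team false true  = TeamSet.at1 T
T ∋ team true  true  = TeamSet.at01 T

tabT : (Team → Bool) → TeamSet
tabT p = teamSet (p (team false false)) (p (team true false)) (p (team false true)) (p (team true true))

-- Functions V → A, represented by (any extension to) functions A → A;
-- there are four of them.
anyFun : ((A → A) → Bool) → Bool
anyFun p = p (λ _ → false) ∨ p (λ _ → true) ∨ p (λ a → a) ∨ p not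

-- a ≈_J b : a and b agree on N ∖ J
approx : Idx → A → A → Bool
approx true  a b = true          -- N ∖ J = ∅
approx false a b = eqA a b       -- N ∖ J = {0}

splitJ : Idx → Team → Team → Team → Bool
splitJ J V V₁ V₂ =
  allA (λ a → eqA (mem a V₁ ∨ mem a V₂) (mem a V))
  ∧ allA (λ a → not (mem a V₁ ∧ mem a V₂))
  ∧ closed V₁ ∧ closed V₂
  where
  closed : Team → Bool
  closed Vi = allA (λ a → allA (λ b →
    (mem a V ∧ mem b V ∧ approx J a b ∧ mem a Vi) ⇒ᵇ mem b Vi))

indep : Idx → Team → (A → A) → Bool
indep J V f = allA (λ a → allA (λ b →
  (mem a V ∧ mem b V ∧ approx J a b) ⇒ᵇ eqA (f a) (f b)))

updF : Team → (A → A) → Team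
updF V f = mkTeam (λ b → anyA (λ a → mem a V ∧ eqA (f a) b))

updA : Team → Team
updA W = mkTeam (λ b → anyA (λ a → mem a W))

isEmpty : Team → Bool
isEmpty V = allA (λ a → not (mem a V))

record Elem : Set where
  constructor ⟨_,_⟩
  field
    pos : TeamSet
    neg : TeamSet

open Elem public

𝟘 : Elem
𝟘 = ⟨ tabT isEmpty , tabT (λ _ → true) ⟩

𝟙 : Elem
𝟙 = ⟨ tabT (λ _ → true) , tabT isEmpty ⟩

D₀₀ : Elem
D₀₀ = ⟨ tabT (λ V → allA (λ a → mem a V ⇒ᵇ eqA a a))
      , tabT (λ V → allA (λ a → mem a V ⇒ᵇ not (eqA a a))) ⟩

¬ₑ : Elem → Elem
¬ₑ X = ⟨ neg X , pos X ⟩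

joinT : Idx → TeamSet → TeamSet → TeamSet
joinT J S T = tabT (λ V → anyTeam (λ V₁ → anyTeam (λ V₂ →
  splitJ J V V₁ V₂ ∧ (S ∋ V₁) ∧ (T ∋ V₂))))

meetT : TeamSet → TeamSet → TeamSet
meetT S T = tabT (λ V → (S ∋ V) ∧ (T ∋ V))

plus : Idx → Elem → Elem → Elem
plus J X Y = ⟨ joinT J (pos X) (pos Y) , meetT (neg X) (neg Y) ⟩

times : Idx → Elem → Elem → Elem
times J X Y = ⟨ meetT (pos X) (pos Y) , joinT J (neg X) (neg Y) ⟩

cyl : Idx → Elem → Elem
cyl J X = ⟨ tabT (λ V → anyFun (λ f → indep J V f ∧ (pos X ∋ updF V f)))
          , tabT (λ W → neg X ∋ updA W) ⟩

data Term : Set where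
  v₀ c₀ c₁ : Term

evalT : Term → A → A
evalT v₀ a = a
evalT c₀ a = false
evalT c₁ a = true

data Formula : Set where
  _≐_   : Term → Term → Formula
  ∼_    : Formula → Formula
  _∨/_⟨_⟩ : Formula → Idx → Formula → Formula
  ∃v₀/_·_ : Idx → Formula → Formula

mutual
  sat⁺ : Formula → Team → Bool
  sat⁺ (t ≐ u) V = allA (λ a → mem a V ⇒ᵇ eqA (evalT t a) (evalT u a))
  sat⁺ (∼ φ) V = sat⁻ φ V
  sat⁺ (φ ∨/ J ⟨ ψ ⟩) V = anyTeam (λ V₁ → anyTeam (λ V₂ →
    splitJ J V V₁ V₂ ∧ sat⁺ φ V₁ ∧ sat⁺ ψ V₂))
  sat⁺ (∃v₀/ J · φ) V = anyFun (λ f → indep J V f ∧ sat⁺ φ (updF V f))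

  sat⁻ : Formula → Team → Bool
  sat⁻ (t ≐ u) W = allA (λ a → mem a W ⇒ᵇ not (eqA (evalT t a) (evalT u a)))
  sat⁻ (∼ φ) W = sat⁺ φ W
  sat⁻ (φ ∨/ J ⟨ ψ ⟩) W = sat⁻ φ W ∧ sat⁻ ψ W
  sat⁻ (∃v₀/ J · φ) W = sat⁻ φ (updA W)

meaning : Formula → Elem
meaning φ = ⟨ tabT (sat⁺ φ) , tabT (sat⁻ φ) ⟩

InCs : Elem → Set
InCs X = Σ Formula (λ φ → meaning φ ≡ X)

record IsSubalgebra (S : Elem → Bool) : Set where
  field
    sub        : ∀ X → S X ≡ true → InCs X
    has𝟘       : S 𝟘 ≡ true
    has𝟙       : S 𝟙 ≡ true
    hasD₀₀     : S D₀₀ ≡ true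
    closed¬    : ∀ X → S X ≡ true → S (¬ₑ X) ≡ true
    closedPlus : ∀ J X Y → S X ≡ true → S Y ≡ true → S (plus J X Y) ≡ true
    closedTimes : ∀ J X Y → S X ≡ true → S Y ≡ true → S (times J X Y) ≡ true
    closedCyl  : ∀ J X → S X ≡ true → S (cyl J X) ≡ true

record IsCongruence (S : Elem → Bool) (R : Elem → Elem → Bool) : Set where
  field
    refl′  : ∀ X → S X ≡ true → R X X ≡ true
    sym′   : ∀ X Y → S X ≡ true → S Y ≡ true → R X Y ≡ true → R Y X ≡ true
    trans′ : ∀ X Y Z → S X ≡ true → S Y ≡ true → S Z ≡ true →
             R X Y ≡ true → R Y Z ≡ true → R X Z ≡ true
    cong¬  : ∀ X X′ → S X ≡ true → S X′ ≡ true →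
             R X X′ ≡ true → R (¬ₑ X) (¬ₑ X′) ≡ true
    congPlus : ∀ J X X′ Y Y′ → S X ≡ true → S X′ ≡ true → S Y ≡ true → S Y′ ≡ true →
               R X X′ ≡ true → R Y Y′ ≡ true → R (plus J X Y) (plus J X′ Y′) ≡ true
    congTimes : ∀ J X X′ Y Y′ → S X ≡ true → S X′ ≡ true → S Y ≡ true → S Y′ ≡ true →
                R X X′ ≡ true → R Y Y′ ≡ true → R (times J X Y) (times J X′ Y′) ≡ true
    congCyl : ∀ J X X′ → S X ≡ true → S X′ ≡ true →
              R X X′ ≡ true → R (cyl J X) (cyl J X′) ≡ true

IsIdentity : (Elem → Bool) → (Elem → Elem → Bool) → Set
IsIdentity S R = ∀ X Y → S X ≡ true → S Y ≡ true → (R X Y ≡ true → X ≡ Y) × (X ≡ Y → R X Y ≡ true)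

IsTotal : (Elem → Bool) → (Elem → Elem → Bool) → Set
IsTotal S R = ∀ X Y → S X ≡ true → S Y ≡ true → R X Y ≡ true

IsSimple : (Elem → Bool) → Set
IsSimple S = ∀ R → IsCongruence S R → IsIdentity S R ⊎ IsTotal S R

HereditarilySimple : Set
HereditarilySimple = ∀ S → IsSubalgebra S → IsSimple S

-- 1. Every meaning of an IFG₁-formula over 𝟐 lies in an explicit list `Cs`
--    of eleven elements: the list contains the atomic meanings and is closed
--    under all operations (checked by evaluation), so induction on formulas
--    applies.
-- 2. Fix a subalgebra S and a congruence R on it.  Unary polynomials with a
--    parameter from S preserve both S and R.
-- 3. The cylindrification C = cyl false maps Cs into the three "truth values"
--    𝟘, undet and 𝟙; since negation fixes undet and swaps 𝟘 and 𝟙, a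
--    congruence relating two distinct truth values relates 𝟘 and 𝟙.
-- 4. Any two distinct X, Y ∈ Cs are separated by one of ten polynomials
--    Z ↦ C (p Z) with parameter Y, so a congruence relating distinct
--    elements relates 𝟘 and 𝟙.
-- 5. If R relates 𝟘 and 𝟙 it is total, because X = X·𝟙 R X·𝟘 = 𝟘.
-- Hence R is the identity or the total relation according as R 𝟘 𝟙 fails
-- or holds.
module Submission where

open import Defs
open import Data.Bool using (Bool; true; false)
open import Data.Bool.Properties using () renaming (_≟_ to _≟ᵇ_)
open import Data.Empty using (⊥-elim)
open import Data.List using (List; []; _∷_)
open import Data.List.Relation.Unary.All as All using (all?)
open import Data.List.Relation.Unary.Any using (Any; any?; here; there)
open import Data.Product using (_×_; _,_)
open import Data.Sum using (_⊎_; inj₁; inj₂; [_,_]′)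
open import Function using (id)
open import Relation.Binary.Definitions using (DecidableEquality)
open import Relation.Binary.PropositionalEquality using (_≡_; _≢_; refl; subst₂)
open import Relation.Nullary using (Dec; yes; no; ¬?)
open import Relation.Nullary.Decidable using (True; toWitness; map′; _×-dec_; _⊎-dec_)

_≟ᵀ_ : DecidableEquality TeamSet
teamSet a b c d ≟ᵀ teamSet a′ b′ c′ d′ =
  map′ (λ { (refl , refl , refl , refl) → refl }) (λ { refl → refl , refl , refl , refl })
       ((a ≟ᵇ a′) ×-dec (b ≟ᵇ b′) ×-dec (c ≟ᵇ c′) ×-dec (d ≟ᵇ d′))

_≟ᴱ_ : DecidableEquality Elem
⟨ p , n ⟩ ≟ᴱ ⟨ p′ , n′ ⟩ =
  map′ (λ { (refl , refl) → refl }) (λ { refl → refl , refl }) ((p ≟ᵀ p′) ×-dec (n ≟ᵀ n′))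

open import Data.List.Membership.DecPropositional _≟ᴱ_ using (_∈_; _∈?_)

-- The element that is neither true nor false on any nonempty team; it is
-- its own negation.
undet : Elem
undet = ⟨ teamSet true false false false , teamSet true false false false ⟩

-- Eleven elements which, by InCs⇒∈Cs below, exhaust Cs_IFG₁(𝟐).
Cs : List Elem
Cs = undet
   ∷ ⟨ teamSet true false false false , teamSet true false true  false ⟩
   ∷ ⟨ teamSet true false false false , teamSet true true  false false ⟩
   ∷ ⟨ teamSet true false false false , teamSet true true  true  false ⟩
   ∷ 𝟘
   ∷ ⟨ teamSet true false true  false , teamSet true false false false ⟩
   ∷ ⟨ teamSet true false true  false , teamSet true true  false false ⟩
   ∷ ⟨ teamSet true true  false false , teamSet true false false false ⟩
   ∷ ⟨ teamSet true true  false false , teamSet true false true  false ⟩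
   ∷ ⟨ teamSet true true  true  false , teamSet true false false false ⟩
   ∷ 𝟙
   ∷ []

checked : ∀ {P : Elem → Set} (P? : ∀ X → Dec (P X)) →
          True (all? P? Cs) → ∀ {X} → X ∈ Cs → P X
checked P? ok = All.lookup (toWitness ok)

checked₂ : ∀ {P : Elem → Elem → Set} (P? : ∀ X Y → Dec (P X Y)) →
           True (all? (λ X → all? (P? X) Cs) Cs) → ∀ {X Y} → X ∈ Cs → Y ∈ Cs → P X Y
checked₂ P? ok X∈ Y∈ = All.lookup (checked (λ X → all? (P? X) Cs) ok X∈) Y∈

¬-closed : ∀ {X} → X ∈ Cs → ¬ₑ X ∈ Cs
¬-closed = checked (λ X → ¬ₑ X ∈? Cs) _

plus-closed : ∀ J {X Y} → X ∈ Cs → Y ∈ Cs → plus J X Y ∈ Cs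
plus-closed false = checked₂ (λ X Y → plus false X Y ∈? Cs) _
plus-closed true  = checked₂ (λ X Y → plus true X Y ∈? Cs) _

cyl-closed : ∀ J {X} → X ∈ Cs → cyl J X ∈ Cs
cyl-closed false = checked (λ X → cyl false X ∈? Cs) _
cyl-closed true  = checked (λ X → cyl true X ∈? Cs) _

atomic-in-Cs : ∀ t u → meaning (t ≐ u) ∈ Cs
atomic-in-Cs t u = toWitness {a? = meaning (t ≐ u) ∈? Cs} (evaluated t u)
  where
  evaluated : ∀ t u → True (meaning (t ≐ u) ∈? Cs)
  evaluated v₀ v₀ = _
  evaluated v₀ c₀ = _
  evaluated v₀ c₁ = _
  evaluated c₀ v₀ = _
  evaluated c₀ c₀ = _
  evaluated c₀ c₁ = _
  evaluated c₁ v₀ = _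
  evaluated c₁ c₀ = _
  evaluated c₁ c₁ = _

meaning-in-Cs : ∀ φ → meaning φ ∈ Cs
meaning-in-Cs (t ≐ u)        = atomic-in-Cs t u
meaning-in-Cs (∼ φ)          = ¬-closed (meaning-in-Cs φ)
meaning-in-Cs (φ ∨/ J ⟨ ψ ⟩) = plus-closed J (meaning-in-Cs φ) (meaning-in-Cs ψ)
meaning-in-Cs (∃v₀/ J · φ)   = cyl-closed J (meaning-in-Cs φ)

InCs⇒∈Cs : ∀ {X} → InCs X → X ∈ Cs
InCs⇒∈Cs (φ , refl) = meaning-in-Cs φ

TruthValues : List Elem
TruthValues = 𝟘 ∷ undet ∷ 𝟙 ∷ []

cyl-truth-value : ∀ J {X} → X ∈ Cs → cyl J X ∈ TruthValues
cyl-truth-value false = checked (λ X → cyl false X ∈? TruthValues) _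
cyl-truth-value true  = checked (λ X → cyl true X ∈? TruthValues) _

times-unit-absorbing : ∀ J {X} → X ∈ Cs → (times J X 𝟙 ≡ X) × (times J X 𝟘 ≡ 𝟘)
times-unit-absorbing false =
  checked (λ X → (times false X 𝟙 ≟ᴱ X) ×-dec (times false X 𝟘 ≟ᴱ 𝟘)) _
times-unit-absorbing true  =
  checked (λ X → (times true X 𝟙 ≟ᴱ X) ×-dec (times true X 𝟘 ≟ᴱ 𝟘)) _

data Poly : Set where
  var param : Poly
  negP      : Poly → Poly
  cylP      : Idx → Poly → Poly
  plusP     : Idx → Poly → Poly → Poly
  timesP    : Idx → Poly → Poly → Poly

⟦_⟧ : Poly → Elem → Elem → Elem
⟦ var ⟧         Y Z = Z
⟦ param ⟧       Y Z = Y
⟦ negP p ⟧      Y Z = ¬ₑ (⟦ p ⟧ Y Z)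
⟦ cylP J p ⟧    Y Z = cyl J (⟦ p ⟧ Y Z)
⟦ plusP J p q ⟧ Y Z = plus J (⟦ p ⟧ Y Z) (⟦ q ⟧ Y Z)
⟦ timesP J p q ⟧ Y Z = times J (⟦ p ⟧ Y Z) (⟦ q ⟧ Y Z)

-- Polynomials p such that Z ↦ cyl false (p Z) separates the elements of
-- Cs: Z, Z + Z, Z · Z, Z + Y, Z · Y and their negations.
separators : List Poly
separators =
  var ∷ plusP false var var ∷ timesP false var var ∷ plusP false var param ∷ timesP false var param ∷
  negP var ∷ negP (plusP false var var) ∷ negP (timesP false var var) ∷
  negP (plusP false var param) ∷ negP (timesP false var param) ∷ []

Separates : Poly → Elem → Elem → Set
Separates p X Y = cyl false (⟦ p ⟧ Y X) ≢ cyl false (⟦ p ⟧ Y Y)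

separation : ∀ {X Y} → X ∈ Cs → Y ∈ Cs → X ≢ Y → Any (λ p → Separates p X Y) separators
separation X∈ Y∈ X≢Y = [ (λ X≡Y → ⊥-elim (X≢Y X≡Y)) , id ]′ (checked₂ separated? _ X∈ Y∈)
  where
  separated? : ∀ X Y → Dec (X ≡ Y ⊎ Any (λ p → Separates p X Y) separators)
  separated? X Y =
    (X ≟ᴱ Y) ⊎-dec any? (λ p → ¬? (cyl false (⟦ p ⟧ Y X) ≟ᴱ cyl false (⟦ p ⟧ Y Y))) separators

module Congruence (S : Elem → Bool) (SA : IsSubalgebra S) (R : Elem → Elem → Bool) (C : IsCongruence S R) where
  open IsSubalgebra SA
  open IsCongruence C

  S⊆Cs : ∀ {X} → S X ≡ true → X ∈ Cs
  S⊆Cs {X} X∈S = InCs⇒∈Cs (sub X X∈S)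

  poly-closed : ∀ p {Y Z} → S Y ≡ true → S Z ≡ true → S (⟦ p ⟧ Y Z) ≡ true
  poly-closed var           Y∈S Z∈S = Z∈S
  poly-closed param         Y∈S Z∈S = Y∈S
  poly-closed (negP p)      Y∈S Z∈S = closed¬ _ (poly-closed p Y∈S Z∈S)
  poly-closed (cylP J p)    Y∈S Z∈S = closedCyl J _ (poly-closed p Y∈S Z∈S)
  poly-closed (plusP J p q) Y∈S Z∈S =
    closedPlus J _ _ (poly-closed p Y∈S Z∈S) (poly-closed q Y∈S Z∈S)
  poly-closed (timesP J p q) Y∈S Z∈S =
    closedTimes J _ _ (poly-closed p Y∈S Z∈S) (poly-closed q Y∈S Z∈S)

  poly-compatible : ∀ p {Y Z Z′} → S Y ≡ true → S Z ≡ true → S Z′ ≡ true →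
                    R Z Z′ ≡ true → R (⟦ p ⟧ Y Z) (⟦ p ⟧ Y Z′) ≡ true
  poly-compatible var   Y∈S Z∈S Z′∈S r = r
  poly-compatible param Y∈S Z∈S Z′∈S r = refl′ _ Y∈S
  poly-compatible (negP p) Y∈S Z∈S Z′∈S r =
    cong¬ _ _ (poly-closed p Y∈S Z∈S) (poly-closed p Y∈S Z′∈S)
          (poly-compatible p Y∈S Z∈S Z′∈S r)
  poly-compatible (cylP J p) Y∈S Z∈S Z′∈S r =
    congCyl J _ _ (poly-closed p Y∈S Z∈S) (poly-closed p Y∈S Z′∈S)
            (poly-compatible p Y∈S Z∈S Z′∈S r)
  poly-compatible (plusP J p q) Y∈S Z∈S Z′∈S r =
    congPlus J _ _ _ _ (poly-closed p Y∈S Z∈S) (poly-closed p Y∈S Z′∈S)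
             (poly-closed q Y∈S Z∈S) (poly-closed q Y∈S Z′∈S)
             (poly-compatible p Y∈S Z∈S Z′∈S r) (poly-compatible q Y∈S Z∈S Z′∈S r)
  poly-compatible (timesP J p q) Y∈S Z∈S Z′∈S r =
    congTimes J _ _ _ _ (poly-closed p Y∈S Z∈S) (poly-closed p Y∈S Z′∈S)
              (poly-closed q Y∈S Z∈S) (poly-closed q Y∈S Z′∈S)
              (poly-compatible p Y∈S Z∈S Z′∈S r) (poly-compatible q Y∈S Z∈S Z′∈S r)

  -- Relating undet with 𝟙 relates 𝟘 with 𝟙: negating gives undet R 𝟘,
  -- as ¬ₑ undet = undet and ¬ₑ 𝟙 = 𝟘 hold by computation.
  undet-collapse : S undet ≡ true → R undet 𝟙 ≡ true → R 𝟘 𝟙 ≡ true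
  undet-collapse u∈S r = trans′ 𝟘 undet 𝟙 has𝟘 u∈S has𝟙 (sym′ undet 𝟘 u∈S has𝟘 undet-R-𝟘) r
    where
    undet-R-𝟘 : R undet 𝟘 ≡ true
    undet-R-𝟘 = cong¬ undet 𝟙 u∈S has𝟙 r

  truth-value-collapse : ∀ {a b} → a ∈ TruthValues → b ∈ TruthValues → a ≢ b →
                         S a ≡ true → S b ≡ true → R a b ≡ true → R 𝟘 𝟙 ≡ true
  truth-value-collapse (here refl) (here refl) a≢b _ _ _ = ⊥-elim (a≢b refl)
  truth-value-collapse (here refl) (there (here refl)) _ _ u∈S r =
    undet-collapse u∈S (cong¬ undet 𝟘 u∈S has𝟘 (sym′ 𝟘 undet has𝟘 u∈S r))
  truth-value-collapse (here refl) (there (there (here refl))) _ _ _ r = r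
  truth-value-collapse (there (here refl)) (here refl) _ u∈S _ r =
    undet-collapse u∈S (cong¬ undet 𝟘 u∈S has𝟘 r)
  truth-value-collapse (there (here refl)) (there (here refl)) a≢b _ _ _ = ⊥-elim (a≢b refl)
  truth-value-collapse (there (here refl)) (there (there (here refl))) _ u∈S _ r =
    undet-collapse u∈S r
  truth-value-collapse (there (there (here refl))) (here refl) _ _ _ r = sym′ 𝟙 𝟘 has𝟙 has𝟘 r
  truth-value-collapse (there (there (here refl))) (there (here refl)) _ _ u∈S r =
    undet-collapse u∈S (sym′ 𝟙 undet has𝟙 u∈S r)
  truth-value-collapse (there (there (here refl))) (there (there (here refl))) a≢b _ _ _ =
    ⊥-elim (a≢b refl)

  -- A congruence relating two distinct elements relates 𝟘 and 𝟙: apply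
  -- the polynomial cyl false ∘ p for a separating p.
  distinct-collapse : ∀ {X Y} → S X ≡ true → S Y ≡ true → X ≢ Y → R X Y ≡ true → R 𝟘 𝟙 ≡ true
  distinct-collapse {X} {Y} X∈S Y∈S X≢Y r = via (separation (S⊆Cs X∈S) (S⊆Cs Y∈S) X≢Y)
    where
    value : ∀ p {Z} → S Z ≡ true → cyl false (⟦ p ⟧ Y Z) ∈ TruthValues
    value p Z∈S = cyl-truth-value false (S⊆Cs (poly-closed p Y∈S Z∈S))

    via : ∀ {ps} → Any (λ p → Separates p X Y) ps → R 𝟘 𝟙 ≡ true
    via (there found) = via found
    via (here {p} separating) =
      truth-value-collapse (value p X∈S) (value p Y∈S) separating
        (poly-closed (cylP false p) Y∈S X∈S) (poly-closed (cylP false p) Y∈S Y∈S)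
        (poly-compatible (cylP false p) Y∈S X∈S Y∈S r)

  -- If R relates 𝟘 and 𝟙 then every X is related to 𝟘, since X = X·𝟙 R X·𝟘 = 𝟘.
  collapse-total : R 𝟘 𝟙 ≡ true → IsTotal S R
  collapse-total r X Y X∈S Y∈S =
    trans′ X 𝟘 Y X∈S has𝟘 Y∈S (sym′ 𝟘 X has𝟘 X∈S (𝟘-R X X∈S)) (𝟘-R Y Y∈S)
    where
    𝟘-R : ∀ X → S X ≡ true → R 𝟘 X ≡ true
    𝟘-R X X∈S with times-unit-absorbing false (S⊆Cs X∈S)
    ... | unit , absorbing =
      subst₂ (λ U V → R U V ≡ true) absorbing unit
        (congTimes false X X 𝟘 𝟙 X∈S X∈S has𝟘 has𝟙 (refl′ X X∈S) r)

  identity-unless-collapse : R 𝟘 𝟙 ≢ true → IsIdentity S R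
  identity-unless-collapse no-collapse X Y X∈S Y∈S = related⇒equal , λ { refl → refl′ X X∈S }
    where
    related⇒equal : R X Y ≡ true → X ≡ Y
    related⇒equal rXY with X ≟ᴱ Y
    ... | yes X≡Y = X≡Y
    ... | no  X≢Y = ⊥-elim (no-collapse (distinct-collapse X∈S Y∈S X≢Y rXY))

  identity-or-total : IsIdentity S R ⊎ IsTotal S R
  identity-or-total with R 𝟘 𝟙 ≟ᵇ true
  ... | yes collapse    = inj₂ (collapse-total collapse)
  ... | no  no-collapse = inj₁ (identity-unless-collapse no-collapse)

mainTheorem3 : (S : Elem → Bool) → IsSubalgebra S → IsSimple S
mainTheorem3 S SA R C = Congruence.identity-or-total S SA R C
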